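{- Let $V$ be an optimal computer. Then for every computer $C$ there exist an oracle deterministic Turing machine $M$ and $d\in\mathbb{N}$ such that, for all $n\in\mathbb{N}^+$, $M^{\mathrm{Dom}\,V\restriction(n+d)}(n)=\mathrm{Dom}\,C\restriction n$, where the finite set $\mathrm{Dom}\,C\restriction n$ is represented as a finite binary string in a fixed format.
   Context: $\{0,1\}^*$ is the set of finite binary strings. A computer is a partial recursive function $C\colon\{0,1\}^*\to\{0,1\}^*$ whose domain $\mathrm{Dom}\,C$ is prefix-free. A computer $U$ is optimal if for every computer $C$ there is $d\in\mathbb{N}$ such that for every $p\in\mathrm{Dom}\,C$ there is $q$ with $U(q)=C(p)$ and $|q|\le|p|+d$. For $S\subseteq\{0,1\}^*$ and $n\in\mathbb{Z}$, $S\restriction n=\{s\in S:|s|\le n\}$. $M^A(n)$ is the output of oracle machine $M$ on input $n$ with oracle set $A$. -}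

module Defs where

open import Data.Nat using (ℕ; zero; suc; _+_; _*_; _≤_; _<_)
open import Data.Fin using (Fin)
open import Data.Vec using (Vec; []; _∷_; lookup)
open import Data.List using (List; []; _∷_; _++_; length; map; concat)
open import Data.List.Relation.Binary.Pointwise using (Pointwise)
open import Data.Bool using (Bool; true; false)
open import Data.Product using (Σ; ∃; _×_; _,_)
open import Data.Empty using (⊥)
open import Function.Bundles using (_⇔_)
open import Relation.Binary.PropositionalEquality using (_≡_)

-- Binary strings and a fixed bijection {0,1}* ≅ ℕ (bijective base 2)

BinStr : Set
BinStr = List Bool

enc : BinStr → ℕ
enc []          = 0
enc (false ∷ s) = 1 + 2 * enc s
enc (true  ∷ s) = 2 + 2 * enc s

_≼_ : BinStr → BinStr → Set
p ≼ q = ∃ λ r → p ++ r ≡ q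

-- Oracle μ-recursive functions (Kleene), with a single oracle-query
-- primitive.  An oracle is a subset of ℕ (given as a predicate).

Oracle : Set₁
Oracle = ℕ → Set

data Code : ℕ → Set where
  Z    : ∀ {n} → Code n
  S    : Code 1
  P    : ∀ {n} → Fin n → Code n
  comp : ∀ {m n} → Code m → Vec (Code n) m → Code n
  prec : ∀ {n} → Code n → Code (suc (suc n)) → Code (suc n)
  mu   : ∀ {n} → Code (suc n) → Code n
  orc  : Code 1

mutual
  data Eval (A : Oracle) : ∀ {n} → Code n → Vec ℕ n → ℕ → Set where
    evZ    : ∀ {n} {xs : Vec ℕ n} → Eval A Z xs 0
    evS    : ∀ {x} → Eval A S (x ∷ []) (suc x)
    evP    : ∀ {n} {i : Fin n} {xs} → Eval A (P i) xs (lookup xs i)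
    evComp : ∀ {m n} {f : Code m} {gs : Vec (Code n) m} {xs ys y} →
             EvalVec A gs xs ys → Eval A f ys y → Eval A (comp f gs) xs y
    evPrecZ : ∀ {n} {g : Code n} {h xs y} →
              Eval A g xs y → Eval A (prec g h) (0 ∷ xs) y
    evPrecS : ∀ {n} {g : Code n} {h k xs z y} →
              Eval A (prec g h) (k ∷ xs) z → Eval A h (k ∷ z ∷ xs) y →
              Eval A (prec g h) (suc k ∷ xs) y
    evMu   : ∀ {n} {f : Code (suc n)} {xs y} →
             Eval A f (y ∷ xs) 0 →
             (∀ z → z < y → ∃ λ k → Eval A f (z ∷ xs) (suc k)) →
             Eval A (mu f) xs y
    evOrc1 : ∀ {x} → A x → Eval A orc (x ∷ []) 1
    evOrc0 : ∀ {x} → (A x → ⊥) → Eval A orc (x ∷ []) 0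

  data EvalVec (A : Oracle) {n} : ∀ {m} → Vec (Code n) m → Vec ℕ n → Vec ℕ m → Set where
    []  : ∀ {xs} → EvalVec A [] xs []
    _∷_ : ∀ {m} {g : Code n} {gs : Vec (Code n) m} {xs y ys} →
          Eval A g xs y → EvalVec A gs xs ys → EvalVec A (g ∷ gs) xs (y ∷ ys)

-- The empty oracle: ordinary (oracle-free) partial recursive functions.
noOracle : Oracle
noOracle _ = ⊥

-- Partial recursive functions {0,1}* ⇀ {0,1}* given by a code e:
--   e(p) ↓= q  iff  φ_e(enc p) ↓= enc q.

Runs : Code 1 → BinStr → BinStr → Set
Runs e p q = Eval noOracle e (enc p ∷ []) (enc q)

InDom : Code 1 → BinStr → Set
InDom e p = ∃ λ q → Runs e p q

PrefixFree : (BinStr → Set) → Set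
PrefixFree D = ∀ p q → D p → D q → p ≼ q → p ≡ q

IsComputer : Code 1 → Set
IsComputer e = PrefixFree (InDom e)

IsOptimal : Code 1 → Set
IsOptimal v = IsComputer v ×
  (∀ c → IsComputer c → ∃ λ d → ∀ p y → Runs c p y →
       ∃ λ q → Runs v q y × length q ≤ length p + d)

_↾_ : (BinStr → Set) → ℕ → BinStr → Set
(D ↾ n) s = D s × length s ≤ n

stringsOfLength : ℕ → List BinStr
stringsOfLength zero    = [] ∷ []
stringsOfLength (suc n) =
  concat (map (λ s → (false ∷ s) ∷ (true ∷ s) ∷ []) (stringsOfLength n))

stringsUpTo : ℕ → List BinStr
stringsUpTo zero    = stringsOfLength 0
stringsUpTo (suc n) = stringsUpTo n ++ stringsOfLength (suc n)

-- Fixed format: a finite set F ⊆ {s : |s| ≤ n} is represented by its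
-- characteristic string over stringsUpTo n (bit i = 1 iff i-th string ∈ F).
Represents : BinStr → ℕ → (BinStr → Set) → Set
Represents b n F = Pointwise (λ bit s → (bit ≡ true) ⇔ F s) b (stringsUpTo n)

asOracle : (BinStr → Set) → Oracle
asOracle D x = ∃ λ s → enc s ≡ x × D s

-- From C build the computer Ĉ (haltingTimeC C) with the same domain
-- which on input p outputs the time C needs to halt on p.  Optimality of V
-- gives d such that each such time is the output of V on some program of
-- length ≤ |p| + d.  Given n and the oracle D = Dom V ↾ (n + d), the machine M
-- waits until V has halted on all of D (a search that terminates because D is
-- finite and V halts on it) and adds up the outputs into a budget T.  Every
-- p ∈ Dom C with |p| ≤ n halts within T steps, so M decides Dom C ↾ n by
-- running C for T steps on each string of length ≤ n and outputs the
-- characteristic string.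
--
-- Excluded middle is used only to
-- evaluate oracle queries and to name the characteristic bits of Dom C ↾ n.
module Submission where

open import Defs
open import Level using (0ℓ)
open import Axiom.ExcludedMiddle using (ExcludedMiddle)
open import Data.Nat using (ℕ; zero; suc; _+_; _*_; _∸_; _≤_; _<_; pred; _⊔_; z≤n; s≤s; _≤?_)
open import Data.Nat.Properties
open import Data.Nat.Solver using (module +-*-Solver)
open import Data.Fin using (Fin; zero; suc)
open import Data.Vec using (Vec; []; _∷_; lookup)
open import Data.List using (List; []; _∷_; _++_; length; concat)
open import Data.List.Properties using (map-++)
open import Data.List.Relation.Binary.Pointwise using (Pointwise; []; _∷_)
open import Data.Bool using (Bool; true; false)
open import Data.Product using (∃; ∃₂; _×_; _,_; proj₂)
open import Data.Sum using (_⊎_; inj₁; inj₂)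
open import Data.Empty using (⊥-elim)
open import Function using (_∘_)
open import Function.Bundles using (_⇔_; mk⇔)
open import Relation.Nullary using (Dec; yes; no; does; ¬_)
open import Relation.Nullary.Decidable using (dec-true; dec-false)
open import Relation.Binary.PropositionalEquality
  using (_≡_; refl; subst; sym; trans; cong; cong₂; module ≡-Reasoning)

module Codes where

  app₁ : ∀ {n} → Code 1 → Code n → Code n
  app₁ f g = comp f (g ∷ [])

  app₂ : ∀ {n} → Code 2 → Code n → Code n → Code n
  app₂ f g h = comp f (g ∷ h ∷ [])

  isZero : ℕ → ℕ
  isZero zero    = 1
  isZero (suc _) = 0

  signum : ℕ → ℕ
  signum x = isZero (isZero x)

  isZero-pos : ∀ {x} → 0 < x → isZero x ≡ 0
  isZero-pos {suc x} _ = refl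

  isZero-nonpos : ∀ {x} → ¬ 0 < x → isZero x ≡ 1
  isZero-nonpos {zero}  _    = refl
  isZero-nonpos {suc x} ¬pos = ⊥-elim (¬pos (s≤s z≤n))

  signum-pos : ∀ {x} → 0 < x → signum x ≡ 1
  signum-pos {suc x} _ = refl

  signum-pos⁻¹ : ∀ {x} → 0 < signum x → 0 < x
  signum-pos⁻¹ {suc x} _ = s≤s z≤n

  signum-+-pos : ∀ a {b} → 0 < b → signum (a + b) ≡ 1
  signum-+-pos a {suc b} _ rewrite +-suc a b = refl

  *-pos⁻¹ : ∀ a b → 0 < a * b → 0 < a × 0 < b
  *-pos⁻¹ (suc a) (suc b) _   = s≤s z≤n , s≤s z≤n
  *-pos⁻¹ (suc a) zero    pos = ⊥-elim (n≮0 (subst (0 <_) (*-zeroʳ (suc a)) pos))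

  -- Codes for constants and basic arithmetic; binary codes recurse on their
  -- first argument.
  oneC : ∀ {n} → Code n
  oneC = app₁ S Z

  constC : ∀ {n} → ℕ → Code n
  constC zero    = Z
  constC (suc k) = app₁ S (constC k)

  addC : Code 2
  addC = prec (P zero) (app₁ S (P (suc zero)))

  mulC : Code 2
  mulC = prec Z (app₂ addC (P (suc (suc zero))) (P (suc zero)))

  predC : Code 1
  predC = prec Z (P zero)

  isZeroC : Code 1
  isZeroC = prec oneC Z

  signumC : Code 1
  signumC = app₁ isZeroC (app₁ isZeroC (P zero))

  -- monusC (k , a) = a ∸ k
  monusC : Code 2
  monusC = prec (P zero) (app₁ predC (P (suc zero)))

  selectC : ∀ {m} n → (Fin n → Fin m) → Vec (Code m) n
  selectC zero    f = []
  selectC (suc n) f = P (f zero) ∷ selectC n (f ∘ suc)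

  module _ {A : Oracle} where

    app₁E : ∀ {n} {f : Code 1} {g : Code n} {xs a b} →
            Eval A g xs a → Eval A f (a ∷ []) b → Eval A (app₁ f g) xs b
    app₁E eg ef = evComp (eg ∷ []) ef

    app₂E : ∀ {n} {f : Code 2} {g h : Code n} {xs a b c} →
            Eval A g xs a → Eval A h xs b → Eval A f (a ∷ b ∷ []) c →
            Eval A (app₂ f g h) xs c
    app₂E eg eh ef = evComp (eg ∷ eh ∷ []) ef

    oneE : ∀ {n} {xs : Vec ℕ n} → Eval A oneC xs 1
    oneE = app₁E evZ evS

    constE : ∀ {n} {xs : Vec ℕ n} k → Eval A (constC k) xs k
    constE zero    = evZ
    constE (suc k) = app₁E (constE k) evS

    addE : ∀ a b → Eval A addC (a ∷ b ∷ []) (a + b)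
    addE zero    b = evPrecZ evP
    addE (suc a) b = evPrecS (addE a b) (app₁E evP evS)

    mulE : ∀ a b → Eval A mulC (a ∷ b ∷ []) (a * b)
    mulE zero    b = evPrecZ evZ
    mulE (suc a) b = evPrecS (mulE a b) (app₂E evP evP (addE b (a * b)))

    predE : ∀ a → Eval A predC (a ∷ []) (pred a)
    predE zero    = evPrecZ evZ
    predE (suc a) = evPrecS (predE a) evP

    isZeroE : ∀ a → Eval A isZeroC (a ∷ []) (isZero a)
    isZeroE zero    = evPrecZ oneE
    isZeroE (suc a) = evPrecS (isZeroE a) evZ

    signumE : ∀ a → Eval A signumC (a ∷ []) (signum a)
    signumE a = app₁E (app₁E evP (isZeroE a)) (isZeroE (isZero a))

    monusE : ∀ k a → Eval A monusC (k ∷ a ∷ []) (a ∸ k)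
    monusE zero    a = evPrecZ evP
    monusE (suc k) a = evPrecS (monusE k a)
      (subst (Eval A _ _) (pred[m∸n]≡m∸[1+n] a k) (app₁E evP (predE (a ∸ k))))

    selectE : ∀ {m n} (f : Fin n → Fin m) (ys : Vec ℕ m) (xs : Vec ℕ n) →
              (∀ i → lookup ys (f i) ≡ lookup xs i) → EvalVec A (selectC n f) ys xs
    selectE f ys []       same = []
    selectE f ys (x ∷ xs) same =
      subst (Eval A (P (f zero)) ys) (same zero) evP ∷ selectE (f ∘ suc) ys xs (same ∘ suc)

-- A step-bounded interpreter.  clock f t xs runs f on xs while allowing every
-- unbounded search to test only the candidates below t; the answer is 0 when
-- the run does not finish within this budget and suc y when it finishes with
-- value y.  Oracle queries are answered by the empty oracle.  The clock is
-- itself computed by a code (clockC), which is how the oracle machine can run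
-- C and V for a bounded time.
module Clock where
  open import Data.Vec using (map)
  open Codes

  allFinished : ∀ {m} → Vec ℕ m → ℕ
  allFinished []       = 1
  allFinished (r ∷ rs) = signum r * allFinished rs

  -- The search state s is 0 while every
  -- candidate tested so far gave a non-zero value, 1 once a candidate did
  -- not finish, and suc (suc y) once y was found to give 0.  Given the clock
  -- answer r of candidate j, a state 0 becomes 1 (r = 0), suc (suc j)
  -- (r = 1) or stays 0 (r ≥ 2); any other state is kept.
  searchStep : ℕ → ℕ → ℕ → ℕ
  searchStep s r j = s + isZero s * (isZero r + (isZero (pred r) * signum r) * suc (suc j))

  mutual
    clock : ∀ {n} → Code n → ℕ → Vec ℕ n → ℕ
    clock Z           t xs       = 1
    clock S           t (x ∷ []) = suc (suc x)
    clock (P i)       t xs       = suc (lookup xs i)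
    clock (comp f gs) t xs       = allFinished (clocks gs t xs) * clock f t (map pred (clocks gs t xs))
    clock (prec g h)  t (k ∷ xs) = clockPrec g h t k xs
    clock (mu f)      t xs       = pred (searchState f t xs t)
    clock orc         t xs       = 1

    clocks : ∀ {n m} → Vec (Code n) m → ℕ → Vec ℕ n → Vec ℕ m
    clocks []       t xs = []
    clocks (g ∷ gs) t xs = clock g t xs ∷ clocks gs t xs

    clockPrec : ∀ {n} → Code n → Code (suc (suc n)) → ℕ → ℕ → Vec ℕ n → ℕ
    clockPrec g h t zero    xs = clock g t xs
    clockPrec g h t (suc k) xs =
      signum (clockPrec g h t k xs) * clock h t (k ∷ pred (clockPrec g h t k xs) ∷ xs)

    searchState : ∀ {n} → Code (suc n) → ℕ → Vec ℕ n → ℕ → ℕ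
    searchState f t xs zero    = 0
    searchState f t xs (suc j) = searchStep (searchState f t xs j) (clock f t (j ∷ xs)) j

  -- Codes for the clock.  clockC f takes the budget t as an extra first
  -- argument; the code mirrors the recursion equations of clock.
  searchStepC : Code 3
  searchStepC = app₂ addC (P zero) (app₂ mulC (app₁ isZeroC (P zero))
                  (app₂ addC (app₁ isZeroC (P (suc zero)))
                     (app₂ mulC (app₂ mulC (app₁ isZeroC (app₁ predC (P (suc zero))))
                                           (app₁ signumC (P (suc zero))))
                                (app₁ S (app₁ S (P (suc (suc zero))))))))

  skip3 : ∀ {n} → Fin n → Fin (suc (suc (suc n)))
  skip3 i = suc (suc (suc i))

  mutual
    clockC : ∀ {n} → Code n → Code (suc n)
    clockC Z           = oneC
    clockC S           = app₁ S (app₁ S (P (suc zero)))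
    clockC (P i)       = app₁ S (P (suc i))
    clockC (comp f gs) = app₂ mulC (allFinishedC gs) (comp (clockC f) (P zero ∷ predClocksC gs))
    clockC (prec g h)  = comp (prec (clockC g) (clockPrecStepC h))
                              (P (suc zero) ∷ P zero ∷ selectC _ (λ i → suc (suc i)))
    clockC (mu f)      = app₁ predC (comp (prec Z (searchStateStepC f))
                                          (P zero ∷ P zero ∷ selectC _ suc))
    clockC orc         = oneC

    allFinishedC : ∀ {n m} → Vec (Code n) m → Code (suc n)
    allFinishedC []       = oneC
    allFinishedC (g ∷ gs) = app₂ mulC (app₁ signumC (clockC g)) (allFinishedC gs)

    predClocksC : ∀ {n m} → Vec (Code n) m → Vec (Code (suc n)) m
    predClocksC []       = []
    predClocksC (g ∷ gs) = app₁ predC (clockC g) ∷ predClocksC gs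

    -- Recursion step of clockPrec, on arguments (k , previous , t , xs).
    clockPrecStepC : ∀ {n} → Code (suc (suc n)) → Code (suc (suc (suc n)))
    clockPrecStepC {n} h = app₂ mulC (app₁ signumC (P (suc zero)))
      (comp (clockC h) (P (suc (suc zero)) ∷ P zero ∷ app₁ predC (P (suc zero)) ∷ selectC n skip3))

    -- Recursion step of searchState, on arguments (j , state , t , xs).
    searchStateStepC : ∀ {n} → Code (suc n) → Code (suc (suc (suc n)))
    searchStateStepC {n} f = comp searchStepC
      (P (suc zero) ∷ comp (clockC f) (P (suc (suc zero)) ∷ P zero ∷ selectC n skip3) ∷ P zero ∷ [])

  module _ {A : Oracle} where

    searchStepE : ∀ s r j → Eval A searchStepC (s ∷ r ∷ j ∷ []) (searchStep s r j)
    searchStepE s r j =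
      app₂E evP (app₂E (app₁E evP (isZeroE s))
        (app₂E (app₁E evP (isZeroE r))
           (app₂E (app₂E (app₁E (app₁E evP (predE r)) (isZeroE (pred r)))
                         (app₁E evP (signumE r)) (mulE _ _))
                  (app₁E (app₁E evP evS) evS) (mulE _ _))
           (addE _ _))
        (mulE _ _))
      (addE _ _)

    mutual
      clockE : ∀ {n} (f : Code n) t xs → Eval A (clockC f) (t ∷ xs) (clock f t xs)
      clockE Z           t xs       = oneE
      clockE S           t (x ∷ []) = app₁E (app₁E evP evS) evS
      clockE (P i)       t xs       = app₁E evP evS
      clockE (comp f gs) t xs       =
        app₂E (allFinishedE gs t xs) (evComp (evP ∷ predClocksE gs t xs) (clockE f t _)) (mulE _ _)
      clockE (prec g h)  t (k ∷ xs) =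
        evComp (evP ∷ evP ∷ selectE _ _ xs (λ _ → refl)) (clockPrecE g h t k xs)
      clockE (mu f)      t xs       =
        app₁E (evComp (evP ∷ evP ∷ selectE _ _ xs (λ _ → refl)) (searchStateE f t xs t)) (predE _)
      clockE orc         t xs       = oneE

      allFinishedE : ∀ {n m} (gs : Vec (Code n) m) t xs →
                     Eval A (allFinishedC gs) (t ∷ xs) (allFinished (clocks gs t xs))
      allFinishedE []       t xs = oneE
      allFinishedE (g ∷ gs) t xs = app₂E (app₁E (clockE g t xs) (signumE _)) (allFinishedE gs t xs) (mulE _ _)

      predClocksE : ∀ {n m} (gs : Vec (Code n) m) t xs →
                    EvalVec A (predClocksC gs) (t ∷ xs) (map pred (clocks gs t xs))
      predClocksE []       t xs = []
      predClocksE (g ∷ gs) t xs = app₁E (clockE g t xs) (predE _) ∷ predClocksE gs t xs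

      clockPrecE : ∀ {n} (g : Code n) h t k xs →
                   Eval A (prec (clockC g) (clockPrecStepC h)) (k ∷ t ∷ xs) (clockPrec g h t k xs)
      clockPrecE g h t zero    xs = evPrecZ (clockE g t xs)
      clockPrecE g h t (suc k) xs = evPrecS (clockPrecE g h t k xs)
        (app₂E (app₁E evP (signumE _))
               (evComp (evP ∷ evP ∷ app₁E evP (predE _) ∷ selectE _ _ xs (λ _ → refl)) (clockE h t _))
               (mulE _ _))

      searchStateE : ∀ {n} (f : Code (suc n)) t xs j →
                     Eval A (prec Z (searchStateStepC f)) (j ∷ t ∷ xs) (searchState f t xs j)
      searchStateE f t xs zero    = evPrecZ evZ
      searchStateE f t xs (suc j) = evPrecS (searchStateE f t xs j)
        (evComp (evP ∷ evComp (evP ∷ evP ∷ selectE _ _ xs (λ _ → refl)) (clockE f t _) ∷ evP ∷ [])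
                (searchStepE _ _ _))

module ClockCorrect where
  open import Data.Vec using (map)
  open import Data.Vec.Properties using (∷-injectiveˡ; ∷-injectiveʳ)
  open Codes
  open Clock

  signum*≡suc : ∀ a b {y} → signum a * b ≡ suc y → ∃ λ z → a ≡ suc z × b ≡ suc y
  signum*≡suc (suc a) b eq = a , refl , trans (sym (+-identityʳ b)) eq

  map-pred-suc : ∀ {m} (ys : Vec ℕ m) → map pred (map suc ys) ≡ ys
  map-pred-suc []       = refl
  map-pred-suc (y ∷ ys) = cong (y ∷_) (map-pred-suc ys)

  allFinished-suc : ∀ {m} (ys : Vec ℕ m) → allFinished (map suc ys) ≡ 1
  allFinished-suc []       = refl
  allFinished-suc (y ∷ ys) rewrite allFinished-suc ys = refl

  allFinished*≡suc : ∀ {m} (rs : Vec ℕ m) v {y} → allFinished rs * v ≡ suc y →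
                     ∃ λ ys → rs ≡ map suc ys × v ≡ suc y
  allFinished*≡suc []           v eq = [] , refl , trans (sym (+-identityʳ v)) eq
  allFinished*≡suc (suc r ∷ rs) v eq
    with allFinished*≡suc rs v (trans (cong (_* v) (sym (*-identityˡ (allFinished rs)))) eq)
  ... | ys , rs≡ , v≡ = r ∷ ys , cong (suc r ∷_) rs≡ , v≡

  pred≡suc : ∀ x {y} → pred x ≡ suc y → x ≡ suc (suc y)
  pred≡suc (suc x) refl = refl

  clock-comp : ∀ {n m} (f : Code m) (gs : Vec (Code n) m) t xs ys {y} →
               clocks gs t xs ≡ map suc ys → clock f t ys ≡ suc y → clock (comp f gs) t xs ≡ suc y
  clock-comp f gs t xs ys gs≡ f≡ rewrite gs≡ | allFinished-suc ys | map-pred-suc ys = trans (+-identityʳ _) f≡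

  clockPrec-suc : ∀ {n} (g : Code n) h t k xs z {y} → clockPrec g h t k xs ≡ suc z →
                  clock h t (k ∷ z ∷ xs) ≡ suc y → clockPrec g h t (suc k) xs ≡ suc y
  clockPrec-suc g h t k xs z k≡ h≡ rewrite k≡ = trans (+-identityʳ _) h≡

  clock-comp⁻¹ : ∀ {n m} (f : Code m) (gs : Vec (Code n) m) t xs {y} → clock (comp f gs) t xs ≡ suc y →
                 ∃ λ ys → clocks gs t xs ≡ map suc ys × clock f t ys ≡ suc y
  clock-comp⁻¹ f gs t xs f≡ with allFinished*≡suc (clocks gs t xs) _ f≡
  ... | ys , gs≡ , outer≡ =
    ys , gs≡ , subst (λ v → clock f t v ≡ _) (trans (cong (map pred) gs≡) (map-pred-suc ys)) outer≡

  clockPrec-suc⁻¹ : ∀ {n} (g : Code n) h t k xs {y} → clockPrec g h t (suc k) xs ≡ suc y →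
                    ∃ λ z → clockPrec g h t k xs ≡ suc z × clock h t (k ∷ z ∷ xs) ≡ suc y
  clockPrec-suc⁻¹ g h t k xs f≡ with signum*≡suc (clockPrec g h t k xs) _ f≡
  ... | z , k≡ , h≡ = z , k≡ , subst (λ r → clock h t (k ∷ pred r ∷ xs) ≡ _) k≡ h≡

  Passed : ∀ {n} → Code (suc n) → ℕ → Vec ℕ n → ℕ → Set
  Passed f t xs y = ∀ z → z < y → ∃ λ k → clock f t (z ∷ xs) ≡ suc (suc k)

  searchStep-keep : ∀ s r j → searchStep (suc s) r j ≡ suc s
  searchStep-keep s r j = +-identityʳ (suc s)

  searchStep-hit : ∀ j → searchStep 0 1 j ≡ suc (suc j)
  searchStep-hit j = trans (+-identityʳ _) (+-identityʳ _)

  searchState-passed : ∀ {n} (f : Code (suc n)) t xs j → Passed f t xs j → searchState f t xs j ≡ 0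
  searchState-passed f t xs zero    passed = refl
  searchState-passed f t xs (suc j) passed
    with searchState-passed f t xs j (λ z z<j → passed z (m≤n⇒m≤1+n z<j)) | passed j ≤-refl
  ... | state≡ | k , clock≡ rewrite state≡ | clock≡ = refl

  searchState-found : ∀ {n} (f : Code (suc n)) t xs y j → clock f t (y ∷ xs) ≡ 1 →
                      Passed f t xs y → y < j → searchState f t xs j ≡ suc (suc y)
  searchState-found f t xs y (suc j) hit passed (s≤s y≤j) with m≤n⇒m<n∨m≡n y≤j
  ... | inj₁ y<j rewrite searchState-found f t xs y j hit passed y<j =
    searchStep-keep (suc y) (clock f t (j ∷ xs)) j
  ... | inj₂ refl rewrite searchState-passed f t xs y passed | hit = searchStep-hit y

  searchState-0⇒passed : ∀ {n} (f : Code (suc n)) t xs j → searchState f t xs j ≡ 0 → Passed f t xs j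
  searchState-0⇒passed f t xs (suc j) state≡ z z<1+j
    with searchState f t xs j in prev | clock f t (j ∷ xs) in answer
  searchState-0⇒passed f t xs (suc j) () z z<1+j | suc s | r
  searchState-0⇒passed f t xs (suc j) () z z<1+j | zero | zero
  searchState-0⇒passed f t xs (suc j) state≡ z z<1+j | zero | suc zero
    with () ← trans (sym (searchStep-hit j)) state≡
  searchState-0⇒passed f t xs (suc j) state≡ z z<1+j | zero | suc (suc k) with m<1+n⇒m<n∨m≡n z<1+j
  ... | inj₁ z<j  = searchState-0⇒passed f t xs j prev z z<j
  ... | inj₂ refl = k , answer

  searchState-inv : ∀ {n} (f : Code (suc n)) t xs j {y} → searchState f t xs j ≡ suc (suc y) →
                    y < j × clock f t (y ∷ xs) ≡ 1 × Passed f t xs y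
  searchState-inv f t xs (suc j) state≡
    with searchState f t xs j in prev | clock f t (j ∷ xs) in answer
  ... | suc s | r with searchState-inv f t xs j (trans prev (trans (sym (searchStep-keep s r j)) state≡))
  ...   | y<j , hit , passed = m≤n⇒m≤1+n y<j , hit , passed
  searchState-inv f t xs (suc j) () | zero | zero
  searchState-inv f t xs (suc j) state≡ | zero | suc zero with refl ← trans (sym (searchStep-hit j)) state≡ =
    ≤-refl , answer , searchState-0⇒passed f t xs j prev
  searchState-inv f t xs (suc j) () | zero | suc (suc k)

  mutual
    clock-mono : ∀ {n} (f : Code n) {t t'} xs {y} → t ≤ t' → clock f t xs ≡ suc y → clock f t' xs ≡ suc y
    clock-mono Z           xs       t≤t' f≡ = f≡
    clock-mono S           (x ∷ []) t≤t' f≡ = f≡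
    clock-mono (P i)       xs       t≤t' f≡ = f≡
    clock-mono orc         xs       t≤t' f≡ = f≡
    clock-mono (comp f gs) {t} {t'} xs t≤t' f≡ with clock-comp⁻¹ f gs t xs f≡
    ... | ys , gs≡ , outer≡ =
      clock-comp f gs t' xs ys (clocks-mono gs xs t≤t' gs≡) (clock-mono f ys t≤t' outer≡)
    clock-mono (prec g h)  (k ∷ xs) t≤t' f≡ = clockPrec-mono g h k xs t≤t' f≡
    clock-mono (mu f)      {t} {t'} xs t≤t' f≡ with searchState-inv f t xs t (pred≡suc _ f≡)
    ... | y<t , hit , passed = cong pred (searchState-found f t' xs _ t' (clock-mono f _ t≤t' hit)
      (λ z z<y → let (k , z≡) = passed z z<y in k , clock-mono f _ t≤t' z≡) (<-≤-trans y<t t≤t'))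

    clocks-mono : ∀ {n m} (gs : Vec (Code n) m) {t t'} xs {ys} → t ≤ t' →
                  clocks gs t xs ≡ map suc ys → clocks gs t' xs ≡ map suc ys
    clocks-mono []       xs {[]}     t≤t' gs≡ = refl
    clocks-mono (g ∷ gs) xs {y ∷ ys} t≤t' gs≡ =
      cong₂ _∷_ (clock-mono g xs t≤t' (∷-injectiveˡ gs≡)) (clocks-mono gs xs t≤t' (∷-injectiveʳ gs≡))

    clockPrec-mono : ∀ {n} (g : Code n) h {t t'} k xs {y} → t ≤ t' →
                     clockPrec g h t k xs ≡ suc y → clockPrec g h t' k xs ≡ suc y
    clockPrec-mono g h zero    xs t≤t' f≡ = clock-mono g xs t≤t' f≡
    clockPrec-mono g h {t} {t'} (suc k) xs t≤t' f≡ with clockPrec-suc⁻¹ g h t k xs f≡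
    ... | z , k≡ , h≡ =
      clockPrec-suc g h t' k xs z (clockPrec-mono g h k xs t≤t' k≡) (clock-mono h _ t≤t' h≡)

  mutual
    clock-sound : ∀ {n} (f : Code n) t xs {y} → clock f t xs ≡ suc y → Eval noOracle f xs y
    clock-sound Z           t xs       refl = evZ
    clock-sound S           t (x ∷ []) refl = evS
    clock-sound (P i)       t xs       refl = evP
    clock-sound orc         t (x ∷ []) refl = evOrc0 (λ ())
    clock-sound (comp f gs) t xs f≡ with clock-comp⁻¹ f gs t xs f≡
    ... | ys , gs≡ , outer≡ = evComp (clocks-sound gs t xs gs≡) (clock-sound f t ys outer≡)
    clock-sound (prec g h)  t (k ∷ xs) f≡ = clockPrec-sound g h t k xs f≡
    clock-sound (mu f)      t xs f≡ with searchState-inv f t xs t (pred≡suc _ f≡)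
    ... | _ , hit , passed =
      evMu (clock-sound f t _ hit) (λ z z<y → let (k , z≡) = passed z z<y in k , clock-sound f t _ z≡)

    clocks-sound : ∀ {n m} (gs : Vec (Code n) m) t xs {ys} →
                   clocks gs t xs ≡ map suc ys → EvalVec noOracle gs xs ys
    clocks-sound []       t xs {[]}     gs≡ = []
    clocks-sound (g ∷ gs) t xs {y ∷ ys} gs≡ =
      clock-sound g t xs (∷-injectiveˡ gs≡) ∷ clocks-sound gs t xs (∷-injectiveʳ gs≡)

    clockPrec-sound : ∀ {n} (g : Code n) h t k xs {y} →
                      clockPrec g h t k xs ≡ suc y → Eval noOracle (prec g h) (k ∷ xs) y
    clockPrec-sound g h t zero    xs f≡ = evPrecZ (clock-sound g t xs f≡)
    clockPrec-sound g h t (suc k) xs f≡ with clockPrec-suc⁻¹ g h t k xs f≡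
    ... | z , k≡ , h≡ = evPrecS (clockPrec-sound g h t k xs k≡) (clock-sound h t _ h≡)

  passed-budget : ∀ {n} (f : Code (suc n)) xs y →
    (∀ z → z < y → ∃ λ t → ∃ λ k → clock f t (z ∷ xs) ≡ suc (suc k)) → ∃ λ t → Passed f t xs y
  passed-budget f xs zero    each = 0 , λ z ()
  passed-budget f xs (suc y) each
    with passed-budget f xs y (λ z z<y → each z (m≤n⇒m≤1+n z<y)) | each y ≤-refl
  ... | t₁ , passed | t₂ , k , y≡ = t₁ ⊔ t₂ , passedBoth
    where
    passedBoth : Passed f (t₁ ⊔ t₂) xs (suc y)
    passedBoth z z<1+y with m<1+n⇒m<n∨m≡n z<1+y
    ... | inj₁ z<y  = let (k' , z≡) = passed z z<y in k' , clock-mono f _ (m≤m⊔n t₁ t₂) z≡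
    ... | inj₂ refl = k , clock-mono f _ (m≤n⊔m t₁ t₂) y≡

  mutual
    clock-complete : ∀ {n} {f : Code n} {xs y} → Eval noOracle f xs y → ∃ λ t → clock f t xs ≡ suc y
    clock-complete evZ        = 0 , refl
    clock-complete evS        = 0 , refl
    clock-complete evP        = 0 , refl
    clock-complete (evOrc0 _) = 0 , refl
    clock-complete {f = comp f gs} {xs} (evComp {ys = ys} egs ef)
      with clocks-complete egs | clock-complete ef
    ... | t₁ , gs≡ | t₂ , f≡ = t₁ ⊔ t₂ , clock-comp f gs _ xs ys
      (clocks-mono gs xs (m≤m⊔n t₁ t₂) gs≡) (clock-mono f ys (m≤n⊔m t₁ t₂) f≡)
    clock-complete (evPrecZ eg) = clock-complete eg
    clock-complete {f = prec g h} (evPrecS {k = k} {xs} {z} ek eh)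
      with clock-complete ek | clock-complete eh
    ... | t₁ , k≡ | t₂ , h≡ = t₁ ⊔ t₂ , clockPrec-suc g h _ k xs z
      (clockPrec-mono g h k xs (m≤m⊔n t₁ t₂) k≡) (clock-mono h _ (m≤n⊔m t₁ t₂) h≡)
    clock-complete {f = mu f} {xs} {y} (evMu ehit epassed)
      with clock-complete ehit | passed-budget f xs y (λ z z<y → candidate-complete (epassed z z<y))
    ... | t₁ , hit | t₂ , passed = t , cong pred (searchState-found f t xs y t (clock-mono f _ t₁≤t hit)
          (λ z z<y → let (k , z≡) = passed z z<y in k , clock-mono f _ t₂≤t z≡) y<t)
      where
      t = suc y ⊔ (t₁ ⊔ t₂)
      t₁≤t : t₁ ≤ t
      t₁≤t = ≤-trans (m≤m⊔n t₁ t₂) (m≤n⊔m (suc y) (t₁ ⊔ t₂))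
      t₂≤t : t₂ ≤ t
      t₂≤t = ≤-trans (m≤n⊔m t₁ t₂) (m≤n⊔m (suc y) (t₁ ⊔ t₂))
      y<t : y < t
      y<t = m≤m⊔n (suc y) (t₁ ⊔ t₂)

    candidate-complete : ∀ {n} {f : Code (suc n)} {z xs} → (∃ λ k → Eval noOracle f (z ∷ xs) (suc k)) →
                         ∃ λ t → ∃ λ k → clock f t (z ∷ xs) ≡ suc (suc k)
    candidate-complete (k , ez) = let (t , z≡) = clock-complete ez in t , k , z≡

    clocks-complete : ∀ {n m} {gs : Vec (Code n) m} {xs ys} → EvalVec noOracle gs xs ys →
                      ∃ λ t → clocks gs t xs ≡ map suc ys
    clocks-complete []                           = 0 , refl
    clocks-complete {gs = g ∷ gs} {xs} (eg ∷ egs) with clock-complete eg | clocks-complete egs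
    ... | t₁ , g≡ | t₂ , gs≡ = t₁ ⊔ t₂ ,
      cong₂ _∷_ (clock-mono g xs (m≤m⊔n t₁ t₂) g≡) (clocks-mono gs xs (m≤n⊔m t₁ t₂) gs≡)

  eval-deterministic : ∀ {n} {f : Code n} {xs a b} → Eval noOracle f xs a → Eval noOracle f xs b → a ≡ b
  eval-deterministic {f = f} {xs} ea eb with clock-complete ea | clock-complete eb
  ... | t₁ , a≡ | t₂ , b≡ =
    cong pred (trans (sym (clock-mono f xs (m≤m⊔n t₁ t₂) a≡)) (clock-mono f xs (m≤n⊔m t₁ t₂) b≡))

  clock-sound⁺ : ∀ {n} (f : Code n) t xs → 0 < clock f t xs → Eval noOracle f xs (pred (clock f t xs))
  clock-sound⁺ f t xs finished with clock f t xs in answer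
  ... | suc y = clock-sound f t xs answer

  clock-mono⁺ : ∀ {n} (f : Code n) {t t'} xs → t ≤ t' → 0 < clock f t xs → 0 < clock f t' xs
  clock-mono⁺ f {t} xs t≤t' finished with clock f t xs in answer
  ... | suc y rewrite clock-mono f xs t≤t' answer = s≤s z≤n

  clock-complete⁺ : ∀ {n} {f : Code n} {xs y} → Eval noOracle f xs y → ∃ λ t → 0 < clock f t xs
  clock-complete⁺ {f = f} {xs} e with clock-complete e
  ... | t , answer = t , subst (0 <_) (sym answer) (s≤s z≤n)

module Strings where
  open import Data.List using (map)
  open import Data.List.Properties using (∷-injectiveˡ; ∷-injectiveʳ)

  bitValue : Bool → ℕ
  bitValue false = 0
  bitValue true  = 1

  enc-cons : ∀ b s → enc (b ∷ s) ≡ suc (bitValue b + (enc s + enc s))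
  enc-cons false s = cong suc (cong (enc s +_) (+-identityʳ (enc s)))
  enc-cons true  s = cong (λ v → suc (suc v)) (cong (enc s +_) (+-identityʳ (enc s)))

  next : BinStr → BinStr
  next []          = false ∷ []
  next (false ∷ s) = true ∷ s
  next (true ∷ s)  = false ∷ next s

  enc-next : ∀ s → enc (next s) ≡ suc (enc s)
  enc-next []          = refl
  enc-next (false ∷ s) = refl
  enc-next (true ∷ s) rewrite enc-next s = cong suc (*-suc 2 (enc s))

  decode : ℕ → BinStr
  decode zero    = []
  decode (suc x) = next (decode x)

  enc-decode : ∀ x → enc (decode x) ≡ x
  enc-decode zero    = refl
  enc-decode (suc x) = trans (enc-next (decode x)) (cong suc (enc-decode x))

  -- firstOfLength k is the number of strings shorter than k, i.e. the number
  -- of the first string of length k; countOfLength k is the number of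
  -- strings of length k.
  firstOfLength : ℕ → ℕ
  firstOfLength zero    = 0
  firstOfLength (suc k) = suc (firstOfLength k + firstOfLength k)

  countOfLength : ℕ → ℕ
  countOfLength zero    = 1
  countOfLength (suc k) = countOfLength k + countOfLength k

  countUpTo : ℕ → ℕ
  countUpTo m = firstOfLength (suc m)

  firstOfLength-mono : ∀ {m n} → m ≤ n → firstOfLength m ≤ firstOfLength n
  firstOfLength-mono {zero}  z≤n       = z≤n
  firstOfLength-mono {suc m} (s≤s m≤n) = s≤s (+-mono-≤ (firstOfLength-mono m≤n) (firstOfLength-mono m≤n))

  enc-lower : ∀ s → firstOfLength (length s) ≤ enc s
  enc-lower []          = z≤n
  enc-lower (false ∷ s) rewrite enc-cons false s = s≤s (+-mono-≤ (enc-lower s) (enc-lower s))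
  enc-lower (true ∷ s)  rewrite enc-cons true s  = m≤n⇒m≤1+n (s≤s (+-mono-≤ (enc-lower s) (enc-lower s)))

  enc-upper : ∀ s → enc s < firstOfLength (suc (length s))
  enc-upper []          = s≤s z≤n
  enc-upper (false ∷ s) rewrite enc-cons false s = s≤s (+-mono-≤ (enc-upper s) (<⇒≤ (enc-upper s)))
  enc-upper (true ∷ s)  rewrite enc-cons true s  =
    s≤s (subst (_≤ firstOfLength (suc (length s)) + firstOfLength (suc (length s)))
               (cong suc (+-suc (enc s) (enc s)))
               (+-mono-≤ (enc-upper s) (enc-upper s)))

  short⇒enc< : ∀ s m → length s ≤ m → enc s < countUpTo m
  short⇒enc< s m |s|≤m = <-≤-trans (enc-upper s) (firstOfLength-mono (s≤s |s|≤m))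

  enc<⇒short : ∀ s m → enc s < countUpTo m → length s ≤ m
  enc<⇒short s m s<count with length s ≤? m
  ... | yes |s|≤m = |s|≤m
  ... | no  |s|≰m = ⊥-elim (<⇒≱ s<count (≤-trans (firstOfLength-mono (≰⇒> |s|≰m)) (enc-lower s)))

  interval : ℕ → ℕ → List ℕ
  interval a zero    = []
  interval a (suc k) = a ∷ interval (suc a) k

  interval-++ : ∀ a x y → interval a x ++ interval (a + x) y ≡ interval a (x + y)
  interval-++ a zero    y rewrite +-identityʳ a = refl
  interval-++ a (suc x) y rewrite +-suc a x     = cong (a ∷_) (interval-++ (suc a) x y)

  enc-extend : ∀ L a k → map enc L ≡ interval a k →
    map enc (concat (map (λ s → (false ∷ s) ∷ (true ∷ s) ∷ []) L)) ≡ interval (suc (a + a)) (k + k)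
  enc-extend []      a zero    L≡ = refl
  enc-extend (s ∷ L) a (suc k) L≡ with ∷-injectiveˡ L≡ | enc-extend L (suc a) k (∷-injectiveʳ L≡)
  ... | refl | rest≡ =
    trans (cong₂ _∷_ (enc-cons false s) (cong₂ _∷_ (enc-cons true s)
            (trans rest≡ (cong (λ v → interval (suc (suc v)) (k + k)) (+-suc (enc s) (enc s))))))
          (cong (λ m → interval (suc (enc s + enc s)) (suc m)) (sym (+-suc k k)))

  enc-stringsOfLength : ∀ n → map enc (stringsOfLength n) ≡ interval (firstOfLength n) (countOfLength n)
  enc-stringsOfLength zero    = refl
  enc-stringsOfLength (suc n) =
    enc-extend (stringsOfLength n) (firstOfLength n) (countOfLength n) (enc-stringsOfLength n)

  firstOfLength-suc : ∀ n → firstOfLength n + countOfLength n ≡ firstOfLength (suc n)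
  firstOfLength-suc zero    = refl
  firstOfLength-suc (suc n) = cong suc (trans (shuffle (firstOfLength n) (countOfLength n))
                                              (cong₂ _+_ (firstOfLength-suc n) (firstOfLength-suc n)))
    where
    open +-*-Solver
    shuffle : ∀ a b → (a + a) + (b + b) ≡ (a + b) + (a + b)
    shuffle = solve 2 (λ a b → (a :+ a) :+ (b :+ b) := (a :+ b) :+ (a :+ b)) refl

  enc-stringsUpTo : ∀ n → map enc (stringsUpTo n) ≡ interval 0 (countUpTo n)
  enc-stringsUpTo zero    = refl
  enc-stringsUpTo (suc n) = begin
      map enc (stringsUpTo n ++ stringsOfLength (suc n))
    ≡⟨ map-++ enc (stringsUpTo n) _ ⟩
      map enc (stringsUpTo n) ++ map enc (stringsOfLength (suc n))
    ≡⟨ cong₂ _++_ (enc-stringsUpTo n) (enc-stringsOfLength (suc n)) ⟩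
      interval 0 (countUpTo n) ++ interval (countUpTo n) (countOfLength (suc n))
    ≡⟨ interval-++ 0 (countUpTo n) (countOfLength (suc n)) ⟩
      interval 0 (countUpTo n + countOfLength (suc n))
    ≡⟨ cong (interval 0) (firstOfLength-suc (suc n)) ⟩
      interval 0 (countUpTo (suc n)) ∎
    where open ≡-Reasoning

  -- bitsEnc v a k is the number of the bit string v a , v (a + 1) , … ,
  -- v (a + k ∸ 1), where v takes the values 0 (false) and 1 (true).
  bitsEnc : (ℕ → ℕ) → ℕ → ℕ → ℕ
  bitsEnc v a zero    = 0
  bitsEnc v a (suc k) = suc (v a + (bitsEnc v (suc a) k + bitsEnc v (suc a) k))

  bitsEnc-map : ∀ (b : BinStr → Bool) (v : ℕ → ℕ) L a k → map enc L ≡ interval a k →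
    (∀ s → enc s < a + k → v (enc s) ≡ bitValue (b s)) → bitsEnc v a k ≡ enc (map b L)
  bitsEnc-map b v []      a zero    L≡ agree = refl
  bitsEnc-map b v (s ∷ L) a (suc k) L≡ agree with refl ← ∷-injectiveˡ L≡ = begin
      suc (v (enc s) + (bitsEnc v (suc (enc s)) k + bitsEnc v (suc (enc s)) k))
    ≡⟨ cong₂ (λ x r → suc (x + (r + r))) (agree s (m<m+n (enc s) (s≤s z≤n)))
             (bitsEnc-map b v L (suc (enc s)) k (∷-injectiveʳ L≡) agreeTail) ⟩
      suc (bitValue (b s) + (enc (map b L) + enc (map b L)))
    ≡⟨ sym (enc-cons (b s) (map b L)) ⟩
      enc (b s ∷ map b L) ∎
    where
    open ≡-Reasoning
    agreeTail : ∀ s' → enc s' < suc (enc s) + k → v (enc s') ≡ bitValue (b s')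
    agreeTail s' s'< = agree s' (subst (enc s' <_) (sym (+-suc (enc s) k)) s'<)

  -- The same number computed by primitive recursion from the last bit
  -- backwards, which is how the oracle machine produces it.
  bitsFromEnd : (ℕ → ℕ) → ℕ → ℕ → ℕ
  bitsFromEnd v N zero    = 0
  bitsFromEnd v N (suc j) = suc (v (N ∸ suc j) + (bitsFromEnd v N j + bitsFromEnd v N j))

  bitsFromEnd≡bitsEnc : ∀ v N j → j ≤ N → bitsFromEnd v N j ≡ bitsEnc v (N ∸ j) j
  bitsFromEnd≡bitsEnc v N zero    _   = refl
  bitsFromEnd≡bitsEnc v N (suc j) j<N = cong (λ r → suc (v (N ∸ suc j) + (r + r)))
    (trans (bitsFromEnd≡bitsEnc v N j (<⇒≤ j<N)) (cong (λ a → bitsEnc v a j) (+-∸-assoc 1 j<N)))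

module Minimisation where
  open Codes

  Least : (ℕ → Set) → ℕ → Set
  Least Q m = Q m × (∀ z → z < m → ¬ Q z)

  searchBelow : (Q : ℕ → Set) → (∀ n → Dec (Q n)) → ∀ k →
                (∃ λ m → Least Q m) ⊎ (∀ z → z < k → ¬ Q z)
  searchBelow Q Q? zero    = inj₂ (λ z ())
  searchBelow Q Q? (suc k) with searchBelow Q Q? k
  ... | inj₁ least = inj₁ least
  ... | inj₂ none with Q? k
  ...   | yes qk = inj₁ (k , qk , none)
  ...   | no ¬qk = inj₂ noneUpTo
    where
    noneUpTo : ∀ z → z < suc k → ¬ Q z
    noneUpTo z z<1+k with m<1+n⇒m<n∨m≡n z<1+k
    ... | inj₁ z<k  = none z z<k
    ... | inj₂ refl = ¬qk

  leastWitness : (Q : ℕ → Set) → (∀ n → Dec (Q n)) → ∀ n → Q n → ∃ λ m → Least Q m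
  leastWitness Q Q? n qn with searchBelow Q Q? (suc n)
  ... | inj₁ least = least
  ... | inj₂ none  = ⊥-elim (none n ≤-refl qn)

  mu-least : ∀ {A : Oracle} {n} {f : Code (suc n)} {xs} (h : ℕ → ℕ) →
             (∀ z → Eval A f (z ∷ xs) (isZero (h z))) → ∀ t → 0 < h t →
             ∃ λ m → Eval A (mu f) xs m × 0 < h m
  mu-least h ef t pos with leastWitness (λ m → 0 < h m) (λ m → 0 <? h m) t pos
  ... | m , posₘ , before =
    m , evMu (subst (Eval _ _ _) (isZero-pos posₘ) (ef m))
             (λ z z<m → 0 , subst (Eval _ _ _) (isZero-nonpos (before z z<m)) (ef z)) , posₘ

-- The computer Ĉ = haltingTimeC C: on input x it returns the least budget
-- within which C finishes on x.  It has the same domain as C, so it is a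
-- computer whenever C is, and optimality of V applies to it.
module HaltingTime where
  open Codes
  open Clock
  open ClockCorrect
  open Minimisation
  open Strings

  -- On (t , x): 0 iff C finishes on x within budget t.
  haltingTestC : Code 1 → Code 2
  haltingTestC C = app₁ isZeroC (clockC C)

  haltingTimeC : Code 1 → Code 1
  haltingTimeC C = mu (haltingTestC C)

  haltingTestE : ∀ {A : Oracle} C t x → Eval A (haltingTestC C) (t ∷ x ∷ []) (isZero (clock C t (x ∷ [])))
  haltingTestE C t x = app₁E (clockE C t (x ∷ [])) (isZeroE _)

  haltingTime-finishes : ∀ C x t → Eval noOracle (haltingTimeC C) (x ∷ []) t → 0 < clock C t (x ∷ [])
  haltingTime-finishes C x t (evMu test _) with clock C t (x ∷ []) in answer
  ... | suc _ = s≤s z≤n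
  ... | zero with () ← trans (eval-deterministic test (haltingTestE C t x)) (cong isZero answer)

  haltingTime-total : ∀ C x v → Eval noOracle C (x ∷ []) v →
                      ∃ λ t → Eval noOracle (haltingTimeC C) (x ∷ []) t
  haltingTime-total C x v run with clock-complete⁺ run
  ... | t , finished with mu-least (λ t → clock C t (x ∷ [])) (λ t → haltingTestE C t x) t finished
  ...   | m , search , _ = m , search

  haltingTime-dom : ∀ C p → InDom (haltingTimeC C) p → InDom C p
  haltingTime-dom C p (w , time) =
    decode value , subst (Eval noOracle C (enc p ∷ [])) (sym (enc-decode value))
                     (clock-sound⁺ C (enc w) _ (haltingTime-finishes C _ _ time))
    where
    value : ℕ
    value = pred (clock C (enc w) (enc p ∷ []))

  haltingTime-computer : ∀ C → IsComputer C → IsComputer (haltingTimeC C)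
  haltingTime-computer C prefixFree p q p∈ q∈ p≼q =
    prefixFree p q (haltingTime-dom C p p∈) (haltingTime-dom C q q∈) p≼q

-- On input n with oracle D it
-- computes
--   L  = countUpTo (n + d), bounding the numbers of strings of length ≤ n + d;
--   t₀ = the least t such that V finishes within t on every x < L with x ∈ D;
--   T  = the sum of the outputs of V on the x < L with x ∈ D;
-- and outputs the characteristic string, over stringsUpTo n, of the strings on
-- which C finishes within T.
module Machine (V C : Code 1) (d : ℕ) where
  open Codes
  open Clock

  firstOfLengthC : Code 1
  firstOfLengthC = prec Z (app₁ S (app₂ addC (P (suc zero)) (P (suc zero))))

  countUpToC : Code 1
  countUpToC = app₁ firstOfLengthC (app₁ S (P zero))

  boundC : Code 1
  boundC = app₁ countUpToC (app₂ addC (P zero) (constC d))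

  clockVC : Code 2
  clockVC = comp (clockC V) (P (suc zero) ∷ P zero ∷ [])

  -- (x , t) ↦ 1 if x ∉ D or V finishes on x within t, and 0 otherwise
  settledC : Code 2
  settledC = app₁ signumC (app₂ addC (app₁ isZeroC (app₁ orc (P zero))) clockVC)

  allSettledC : Code 2
  allSettledC = prec oneC (app₂ mulC (P (suc zero)) (app₂ settledC (P zero) (P (suc (suc zero)))))

  settleTestC : Code 2
  settleTestC = app₁ isZeroC (app₂ allSettledC (app₁ boundC (P (suc zero))) (P zero))

  settleTimeC : Code 1
  settleTimeC = mu settleTestC

  -- (x , t) ↦ the output of V on x if x ∈ D (computed with budget t), else 0
  outputC : Code 2
  outputC = app₂ mulC (app₁ orc (P zero)) (app₁ predC clockVC)

  outputSumC : Code 2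
  outputSumC = prec Z (app₂ addC (P (suc zero)) (app₂ outputC (P zero) (P (suc (suc zero)))))

  budgetC : Code 1
  budgetC = app₂ outputSumC boundC settleTimeC

  -- (j , _ , n) ↦ whether C finishes within T on the number countUpTo n ∸ (j + 1)
  bitC : Code 3
  bitC = app₁ signumC (comp (clockC C)
    (app₁ budgetC (P (suc (suc zero))) ∷
     app₂ monusC (app₁ S (P zero)) (app₁ countUpToC (P (suc (suc zero)))) ∷ []))

  charStringC : Code 2
  charStringC = prec Z (app₁ S (app₂ addC bitC (app₂ addC (P (suc zero)) (P (suc zero)))))

  M : Code 1
  M = app₂ charStringC (app₁ countUpToC (P zero)) (P zero)

module MachineRun (em : ExcludedMiddle 0ℓ) (V C : Code 1) (d : ℕ) where
  open Codes
  open Clock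
  open ClockCorrect
  open Minimisation
  open Strings
  open Machine V C d

  bound : ℕ → ℕ
  bound n = countUpTo (n + d)

  query : Oracle → ℕ → ℕ
  query B x = bitValue (does (em {B x}))

  query-∈ : ∀ (B : Oracle) x → B x → query B x ≡ 1
  query-∈ B x x∈ = cong bitValue (dec-true em x∈)

  query-∉ : ∀ (B : Oracle) x → ¬ B x → query B x ≡ 0
  query-∉ B x x∉ = cong bitValue (dec-false em x∉)

  module _ (B : Oracle) where

    settled : ℕ → ℕ → ℕ
    settled x t = signum (isZero (query B x) + clock V t (x ∷ []))

    allSettled : ℕ → ℕ → ℕ
    allSettled zero    t = 1
    allSettled (suc L) t = allSettled L t * settled L t

    output : ℕ → ℕ → ℕ
    output x t = query B x * pred (clock V t (x ∷ []))

    outputSum : ℕ → ℕ → ℕ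
    outputSum zero    t = 0
    outputSum (suc L) t = outputSum L t + output L t

    budget : ℕ → ℕ → ℕ
    budget n t₀ = outputSum (bound n) t₀

  halts : ℕ → ℕ → ℕ
  halts T x = signum (clock C T (x ∷ []))

  module _ {B : Oracle} where

    queryE : ∀ x → Eval B orc (x ∷ []) (query B x)
    queryE x = answer em
      where
      answer : (x? : Dec (B x)) → Eval B orc (x ∷ []) (bitValue (does x?))
      answer (yes x∈) = evOrc1 x∈
      answer (no  x∉) = evOrc0 x∉

    firstOfLengthE : ∀ k → Eval B firstOfLengthC (k ∷ []) (firstOfLength k)
    firstOfLengthE zero    = evPrecZ evZ
    firstOfLengthE (suc k) = evPrecS (firstOfLengthE k) (app₁E (app₂E evP evP (addE _ _)) evS)

    countUpToE : ∀ n → Eval B countUpToC (n ∷ []) (countUpTo n)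
    countUpToE n = app₁E (app₁E evP evS) (firstOfLengthE _)

    boundE : ∀ n → Eval B boundC (n ∷ []) (bound n)
    boundE n = app₁E (app₂E evP (constE d) (addE _ _)) (countUpToE _)

    clockVE : ∀ x t → Eval B clockVC (x ∷ t ∷ []) (clock V t (x ∷ []))
    clockVE x t = evComp (evP ∷ evP ∷ []) (clockE V t (x ∷ []))

    settledE : ∀ x t → Eval B settledC (x ∷ t ∷ []) (settled B x t)
    settledE x t =
      app₁E (app₂E (app₁E (app₁E evP (queryE x)) (isZeroE _)) (clockVE x t) (addE _ _)) (signumE _)

    allSettledE : ∀ L t → Eval B allSettledC (L ∷ t ∷ []) (allSettled B L t)
    allSettledE zero    t = evPrecZ oneE
    allSettledE (suc L) t = evPrecS (allSettledE L t) (app₂E evP (app₂E evP evP (settledE L t)) (mulE _ _))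

    settleTestE : ∀ n t → Eval B settleTestC (t ∷ n ∷ []) (isZero (allSettled B (bound n) t))
    settleTestE n t = app₁E (app₂E (app₁E evP (boundE n)) evP (allSettledE _ _)) (isZeroE _)

    outputE : ∀ x t → Eval B outputC (x ∷ t ∷ []) (output B x t)
    outputE x t = app₂E (app₁E evP (queryE x)) (app₁E (clockVE x t) (predE _)) (mulE _ _)

    outputSumE : ∀ L t → Eval B outputSumC (L ∷ t ∷ []) (outputSum B L t)
    outputSumE zero    t = evPrecZ evZ
    outputSumE (suc L) t = evPrecS (outputSumE L t) (app₂E evP (app₂E evP evP (outputE L t)) (addE _ _))

    module _ (n t₀ : ℕ) (settleTime : Eval B settleTimeC (n ∷ []) t₀) where

      budgetE : Eval B budgetC (n ∷ []) (budget B n t₀)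
      budgetE = app₂E (boundE n) settleTime (outputSumE _ _)

      bitE : ∀ j acc → Eval B bitC (j ∷ acc ∷ n ∷ []) (halts (budget B n t₀) (countUpTo n ∸ suc j))
      bitE j acc = app₁E (evComp (app₁E evP budgetE ∷
                                  app₂E (app₁E evP evS) (app₁E evP (countUpToE n)) (monusE _ _) ∷ [])
                                 (clockE C _ _))
                         (signumE _)

      charStringE : ∀ j → Eval B charStringC (j ∷ n ∷ [])
                                  (bitsFromEnd (halts (budget B n t₀)) (countUpTo n) j)
      charStringE zero    = evPrecZ evZ
      charStringE (suc j) =
        evPrecS (charStringE j) (app₁E (app₂E (bitE j _) (app₂E evP evP (addE _ _)) (addE _ _)) evS)

      ME : Eval B M (n ∷ []) (bitsFromEnd (halts (budget B n t₀)) (countUpTo n) (countUpTo n))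
      ME = app₂E (app₁E evP (countUpToE n)) evP (charStringE _)

  Halting : Oracle → Set
  Halting B = ∀ x → B x → ∃ λ y → Eval noOracle V (x ∷ []) y

  settled-∉ : ∀ (B : Oracle) x t → ¬ B x → settled B x t ≡ 1
  settled-∉ B x t x∉ = cong (λ q → signum (isZero q + clock V t (x ∷ []))) (query-∉ B x x∉)

  settled-finished : ∀ (B : Oracle) x {t} → 0 < clock V t (x ∷ []) → settled B x t ≡ 1
  settled-finished B x finished = signum-+-pos (isZero (query B x)) finished

  -- For a halting oracle every x is settled from some budget on, hence so
  -- are all x < L, and the search for t₀ terminates.
  settled-eventually : ∀ {B : Oracle} → Halting B → ∀ x →
                       ∃ λ t → ∀ t' → t ≤ t' → settled B x t' ≡ 1
  settled-eventually {B} halting x = byMembership em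
    where
    byMembership : Dec (B x) → ∃ λ t → ∀ t' → t ≤ t' → settled B x t' ≡ 1
    byMembership (no  x∉) = 0 , λ t' _ → settled-∉ B x t' x∉
    byMembership (yes x∈) with clock-complete⁺ (proj₂ (halting x x∈))
    ... | t , finished = t , λ t' t≤t' → settled-finished B x (clock-mono⁺ V _ t≤t' finished)

  allSettled-eventually : ∀ {B : Oracle} → Halting B → ∀ L →
                          ∃ λ t → ∀ t' → t ≤ t' → allSettled B L t' ≡ 1
  allSettled-eventually halting zero    = 0 , λ _ _ → refl
  allSettled-eventually halting (suc L)
    with allSettled-eventually halting L | settled-eventually halting L
  ... | t₁ , below | t₂ , last = t₁ ⊔ t₂ , λ t' t≤t' →
    cong₂ _*_ (below t' (≤-trans (m≤m⊔n t₁ t₂) t≤t')) (last t' (≤-trans (m≤n⊔m t₁ t₂) t≤t'))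

  settleTime-exists : ∀ {B : Oracle} → Halting B → ∀ n →
                      ∃ λ t₀ → Eval B settleTimeC (n ∷ []) t₀ × 0 < allSettled B (bound n) t₀
  settleTime-exists {B} halting n with allSettled-eventually halting (bound n)
  ... | t , settledFrom = mu-least (allSettled B (bound n)) (settleTestE n) t
                                   (subst (0 <_) (sym (settledFrom t ≤-refl)) (s≤s z≤n))

  allSettled-finished : ∀ (B : Oracle) L t → 0 < allSettled B L t →
                        ∀ x → x < L → B x → 0 < clock V t (x ∷ [])
  allSettled-finished B (suc L) t pos x x<1+L x∈
    with *-pos⁻¹ (allSettled B L t) (settled B L t) pos | m<1+n⇒m<n∨m≡n x<1+L
  ... | below , _    | inj₁ x<L  = allSettled-finished B L t below x x<L x∈
  ... | _     , last | inj₂ refl =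
    signum-pos⁻¹ (subst (λ q → 0 < signum (isZero q + clock V t (x ∷ []))) (query-∈ B x x∈) last)

  output≤outputSum : ∀ (B : Oracle) L t x → x < L → output B x t ≤ outputSum B L t
  output≤outputSum B (suc L) t x x<1+L with m<1+n⇒m<n∨m≡n x<1+L
  ... | inj₁ x<L  = ≤-trans (output≤outputSum B L t x x<L) (m≤m+n _ _)
  ... | inj₂ refl = m≤n+m _ _

module MachineCorrect (em : ExcludedMiddle 0ℓ) (V C : Code 1) (d : ℕ)
  (embed : ∀ p y → Runs (HaltingTime.haltingTimeC C) p y →
                   ∃ λ q → Runs V q y × length q ≤ length p + d) where
  open import Data.List using (map)
  open Codes
  open Clock
  open ClockCorrect
  open Strings
  open HaltingTime
  open Machine V C d
  open MachineRun em V C d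

  oracle : ℕ → Oracle
  oracle n = asOracle (InDom V ↾ (n + d))

  oracle-halting : ∀ n → Halting (oracle n)
  oracle-halting n x (s , refl , (q , run) , _) = enc q , run

  bitOf : ℕ → BinStr → Bool
  bitOf n s = does (em {(InDom C ↾ n) s})

  does⇔ : ∀ {X : Set} (x? : Dec X) → (does x? ≡ true) ⇔ X
  does⇔ (yes x) = mk⇔ (λ _ → x) (λ _ → refl)
  does⇔ (no ¬x) = mk⇔ (λ ()) (λ x → ⊥-elim (¬x x))

  represents : ∀ n → Represents (map (bitOf n) (stringsUpTo n)) n (InDom C ↾ n)
  represents n = bitsOf (stringsUpTo n)
    where
    bitsOf : ∀ L → Pointwise (λ bit s → (bit ≡ true) ⇔ (InDom C ↾ n) s) (map (bitOf n) L) L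
    bitsOf []      = []
    bitsOf (s ∷ L) = does⇔ em ∷ bitsOf L

  module _ (n t₀ : ℕ) (settled₀ : 0 < allSettled (oracle n) (bound n) t₀) where

    T : ℕ
    T = budget (oracle n) n t₀

    -- The halting time t of C on a string p of length ≤ n is the output of V
    -- on some program q of length ≤ n + d, which lies in the oracle; so t is
    -- one of the summands of T.
    haltingTime≤budget : ∀ p t → Eval noOracle (haltingTimeC C) (enc p ∷ []) t → length p ≤ n → t ≤ T
    haltingTime≤budget p t time short
      with embed p (decode t) (subst (Eval noOracle (haltingTimeC C) (enc p ∷ [])) (sym (enc-decode t)) time)
    ... | q , runV , q-short =
      subst (_≤ T) outputIsTime (output≤outputSum (oracle n) (bound n) t₀ (enc q) q<bound)
      where
      open ≡-Reasoning
      q-short' : length q ≤ n + d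
      q-short' = ≤-trans q-short (+-monoˡ-≤ d short)
      q∈ : oracle n (enc q)
      q∈ = q , refl , (decode t , runV) , q-short'
      q<bound : enc q < bound n
      q<bound = short⇒enc< q (n + d) q-short'
      finished : 0 < clock V t₀ (enc q ∷ [])
      finished = allSettled-finished (oracle n) (bound n) t₀ settled₀ (enc q) q<bound q∈
      outputIsTime : output (oracle n) (enc q) t₀ ≡ t
      outputIsTime = begin
          query (oracle n) (enc q) * pred (clock V t₀ (enc q ∷ []))
        ≡⟨ cong₂ _*_ (query-∈ (oracle n) (enc q) q∈)
                     (eval-deterministic (clock-sound⁺ V t₀ _ finished) runV) ⟩
          1 * enc (decode t)
        ≡⟨ *-identityˡ _ ⟩
          enc (decode t)
        ≡⟨ enc-decode t ⟩
          t ∎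

    bit-correct : ∀ s → enc s < countUpTo n → halts T (enc s) ≡ bitValue (bitOf n s)
    bit-correct s s< = byMembership em
      where
      byMembership : (s? : Dec ((InDom C ↾ n) s)) → halts T (enc s) ≡ bitValue (does s?)
      byMembership (yes ((w , runC) , short)) with haltingTime-total C (enc s) (enc w) runC
      ... | t , time = signum-pos (clock-mono⁺ C _ (haltingTime≤budget s t time short)
                                                   (haltingTime-finishes C _ t time))
      byMembership (no s∉) with clock C T (enc s ∷ []) in answer
      ... | zero  = refl
      ... | suc v = ⊥-elim (s∉ ((decode v , subst (Eval noOracle C (enc s ∷ [])) (sym (enc-decode v))
                                                   (clock-sound C T _ answer)) ,
                                 enc<⇒short s n s<))

    output-correct : bitsFromEnd (halts T) (countUpTo n) (countUpTo n) ≡ enc (map (bitOf n) (stringsUpTo n))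
    output-correct = begin
        bitsFromEnd (halts T) N N
      ≡⟨ bitsFromEnd≡bitsEnc (halts T) N N ≤-refl ⟩
        bitsEnc (halts T) (N ∸ N) N
      ≡⟨ cong (λ a → bitsEnc (halts T) a N) (n∸n≡0 N) ⟩
        bitsEnc (halts T) 0 N
      ≡⟨ bitsEnc-map (bitOf n) (halts T) (stringsUpTo n) 0 N (enc-stringsUpTo n) bit-correct ⟩
        enc (map (bitOf n) (stringsUpTo n)) ∎
      where
      open ≡-Reasoning
      N : ℕ
      N = countUpTo n

  correct : ∀ n → ∃ λ (b : BinStr) → Represents b n (InDom C ↾ n) × Eval (oracle n) M (n ∷ []) (enc b)
  correct n with settleTime-exists (oracle-halting n) n
  ... | t₀ , settleTime , settled₀ = map (bitOf n) (stringsUpTo n) , represents n ,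
    subst (Eval (oracle n) M (n ∷ [])) (output-correct n t₀ settled₀) (ME n t₀ settleTime)

open HaltingTime using (haltingTimeC; haltingTime-computer)
open Machine using (M)

corollary3p8 : ExcludedMiddle 0ℓ → (V : Code 1) → IsOptimal V →
    (C : Code 1) → IsComputer C →
      ∃₂ λ (M : Code 1) (d : ℕ) → ∀ (n : ℕ) → 1 ≤ n →
        ∃ λ (b : BinStr) → Represents b n (InDom C ↾ n) ×
          Eval (asOracle (InDom V ↾ (n + d))) M (n ∷ []) (enc b)
corollary3p8 em V (_ , optimal) C computerC
  with optimal (haltingTimeC C) (haltingTime-computer C computerC)
... | d , embed = M V C d , d , λ n _ → MachineCorrect.correct em V C d embed n
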